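{- Let $\mathcal{A}=\langle Q_{\mathcal A},\mathbb N\cup\mathbb T,\Delta_{\mathcal A},\mathcal R_{\mathcal A},\varphi_{\mathcal A}\rangle$ and $\mathcal{B}=\langle Q_{\mathcal B},\mathbb N\cup\mathbb T,\Delta_{\mathcal B},\mathcal R_{\mathcal B},\varphi_{\mathcal B}\rangle$ be (symbolic) level-synchronized tree automata such that the terms in leaf symbols and the global constraints $\varphi_{\mathcal A},\varphi_{\mathcal B}$ are expressed in a decidable theory. Then the entailment-checking procedure $\mathsf{Entail}(\mathcal A,\mathcal B)$ described in the context always terminates.
   Context: LSTAs. A (symbolic) level-synchronized tree automaton (LSTA) is a tuple $\mathcal A=\langle Q,\mathbb N\cup\mathbb T,\Delta,\mathcal R,\varphi\rangle$ where $Q$ is a finite set of states, $\mathcal R\subseteq Q$ is the set of root states, $\mathbb T$ is a set of terms built from complex constants and a set $\mathbb X$ of complex variables using function symbols of some fixed theory, and $\Delta$ is a finite set of transitions, each either internal $q\xrightarrow{f,C}(q_1,q_2)$ with $f\in\mathbb N$ or leaf $q\xrightarrow{f,C}()$ with $f\in\mathbb C\cup\mathbb T$, where $q,q_1,q_2\in Q$ and $C\subseteq\mathbb N$ is a finite set of choices. For a transition $\delta$ we write $\mathrm{top}(\delta)=q$, $\mathrm{sym}(\delta)=f$, $\ell(\delta)=C$, $\mathrm{left}(\delta)=q_1$, $\mathrm{right}(\delta)=q_2$, $\mathrm{bot}(\delta)=\{q_1,q_2\}$ (and $\mathrm{bot}(\delta)=\emptyset$ for leaf transitions). Distinct transitions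 with the same top state have disjoint choice sets. The global constraint $\varphi$ is a formula over $\mathbb X$. $\mathrm{vars}(\cdot)$ denotes the free variables of an object. Feasible transition sets. For an LSTA $\mathcal C$ and a finite set of states $D=\{q_1,\dots,q_k\}$, $\mathrm{feas}(\mathcal C,D)$ is the set of all sets $\{\delta_1,\dots,\delta_k\}$ of transitions of $\mathcal C$ with $\mathrm{top}(\delta_i)=q_i$ for all $i$ and $\bigcap_i\ell(\delta_i)\neq\emptyset$. Procedure $\mathsf{FindAllMappings}(\Gamma_{\mathcal A},f)$, where $\Gamma_{\mathcal A}\subseteq\Delta_{\mathcal A}$ and $f$ maps the tops of $\Gamma_{\mathcal A}$ to subsets of $Q_{\mathcal B}$: let $P=\bigcup$ of the image of $f$, and $F'=\emptyset$. For each $\Gamma_{\mathcal B}\in\mathrm{feas}(\mathcal B,P)$: start with empty maps $f'$ (states of $\mathcal A$ to sets of states of $\mathcal B$) and $g'$ (terms to sets of terms); for each $\delta_{\mathcal A}\in\Gamma_{\mathcal A}$ and each $q\in f(\mathrm{top}(\delta_{\mathcal A}))$, let $\delta_{\mathcal B}$ be the unique transition of $\Gamma_{\mathcal B}$ with top $q$; if both are leaf transitions, add $\mathrm{sym}(\delta_{\mathcal B})$ to $g'(\mathrm{sym}(\delta_{\mathcal A}))$; else if both are internal with equal symbol, add $\mathrm{left}(\delta_{\mathcal B})$ to $f'(\mathrm{left}(\delta_{\mathcal A}))$ and $\mathrm{right}(\delta_{\mathcal B})$ to $f'(\mathrm{right}(\delta_{\mathcal A}))$; otherwise mark this $\Gamma_{\mathcal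 B}$ as failed and stop processing it. If not failed, add $(f',g')$ to $F'$. Return $F'$. Procedure $\mathsf{Entail}(\mathcal A,\mathcal B)$, with $\mathcal R_{\mathcal B}=\{r_1,\dots,r_k\}$: set $\mathit{processed}=\emptyset$ and $\mathit{workset}=\{(\{q\},\{(\{q\mapsto\{r_1\}\},\emptyset),\dots,(\{q\mapsto\{r_k\}\},\emptyset)\})\mid q\in\mathcal R_{\mathcal A}\}$. While $\mathit{workset}$ contains some $(D,F)$: remove it and add it to $\mathit{processed}$. If $D=\emptyset$: let $Y$ be the set of variables occurring in the keys $u_1$ of all entries $u_1\mapsto U_2$ of all $g$ with $(\emptyset,g)\in F$, together with $\mathrm{vars}(\varphi_{\mathcal A})$; let $Z$ be the variables occurring in the value sets $U_2$ of those entries together with $\mathrm{vars}(\varphi_{\mathcal B})$, minus $Y$; if the formula $\forall Y\colon\varphi_{\mathcal A}\Rightarrow\exists Z\colon\varphi_{\mathcal B}\wedge\bigvee_{(\emptyset,g)\in F}\exists r\in\mathbb R\setminus\{0\}\colon\bigwedge_{(u_1\mapsto U_2)\in g,\,u_2\in U_2}u_1=r\cdot u_2$ is not valid, return false. Otherwise (for $D\neq\emptyset$), for each $\Gamma_{\mathcal A}\in\mathrm{feas}(\mathcal A,D)$: let $D'=\bigcup_{\delta\in\Gamma_{\mathcal A}}\mathrm{bot}(\delta)$ and $F'=\bigcup_{(f,g)\in F}\{(f',g\uplus g')\mid(f',g')\in\mathsf{FindAllMappings}(\Gamma_{\mathcal A},f)\}$, where $(g\uplus g')(x)=g(x)\cup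 g'(x)$ for $x$ in the union of the domains; if $(D',F')\notin\mathit{processed}\cup\mathit{workset}$, insert it into $\mathit{workset}$. When the workset is empty, return true. The validity check in the $D=\emptyset$ case is performed by a decision procedure for the underlying theory. -}

module Defs where

open import Data.Bool using (Bool; true; false; _∧_; _∨_; not; if_then_else_)
import Data.Bool as Bool
open import Data.Nat using (ℕ)
import Data.Nat as Nat
open import Data.Fin using (Fin)
import Data.Fin as Fin
open import Data.Fin.Subset using (Subset; ⁅_⁆; _∪_; ⊥; _∈_)
open import Data.Fin.Subset.Properties using (_∈?_)
open import Data.List using (List; []; _∷_; _++_; map; concatMap; filter; foldr; foldl; null; allFin; cartesianProductWith; lookup; length)
open import Data.Bool.ListAction using (any; all)
open import Data.Vec using (Vec; updateAt; replicate)
import Data.Vec as Vec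
open import Data.Maybe using (Maybe; just; nothing)
open import Data.Product using (_×_; _,_; proj₁; proj₂)
open import Relation.Nullary using (Dec; does; ¬_)
open import Relation.Binary.PropositionalEquality using (_≡_)
open import Relation.Binary.Definitions using (DecidableEquality)

-- Leaf symbols (complex constants and terms over complex variables) are
-- elements of Term; global constraints and the entailment formula built
-- in the D = ∅ case are elements of Formula.  The construction of the formula
--   ∀Y: φA ⇒ ∃Z: φB ∧ ⋁_{(∅,g)∈F} ∃ r ∈ ℝ∖{0}: ⋀_{u1↦U2 ∈ g, u2∈U2} u1 = r·u2
-- (including the computation of Y and Z from variable occurrences) is
-- given by entailFormula, taking φA, φB and the list of the maps g,
-- each g represented as the finite relation {(u1,u2) | u2 ∈ g(u1)}.

record Theory : Set₁ where
  field
    Term          : Set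
    _≟ₜ_          : DecidableEquality Term
    Formula       : Set
    Valid         : Formula → Set
    valid?        : (φ : Formula) → Dec (Valid φ)
    entailFormula : Formula → Formula → List (List (Term × Term)) → Formula

-- LSTAs.  States are Fin n; internal symbols are natural numbers
-- (the alphabet ℕ); choice sets are finite sets of naturals (lists).

data Shape (n : ℕ) (T : Set) : Set where
  internal : ℕ → Fin n → Fin n → Shape n T
  leaf     : T → Shape n T

record Transition (n : ℕ) (T : Set) : Set where
  constructor tr
  field
    top     : Fin n
    shape   : Shape n T
    choices : List ℕ

open Transition public

_∈ℕ_ : ℕ → List ℕ → Set
c ∈ℕ C = Data.List.Membership.Propositional._∈_ c C
  where import Data.List.Membership.Propositional

record LSTA (Th : Theory) : Set where
  open Theory Th
  field
    nStates    : ℕ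
    trans      : List (Transition nStates Term)
    roots      : Subset nStates
    constraint : Formula
    disjoint   : (i j : Fin (length trans)) → ¬ (i ≡ j) →
                 top (lookup trans i) ≡ top (lookup trans j) →
                 (c : ℕ) → c ∈ℕ choices (lookup trans i) →
                 ¬ (c ∈ℕ choices (lookup trans j))

memBy : {A : Set} → (A → A → Bool) → A → List A → Bool
memBy eq x ys = any (eq x) ys

subBy : {A : Set} → (A → A → Bool) → List A → List A → Bool
subBy eq xs ys = all (λ x → memBy eq x ys) xs

setEqBy : {A : Set} → (A → A → Bool) → List A → List A → Bool
setEqBy eq xs ys = subBy eq xs ys ∧ subBy eq ys xs

vecEqBy : {A : Set} {n : ℕ} → (A → A → Bool) → Vec A n → Vec A n → Bool
vecEqBy eq Vec.[] Vec.[] = true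
vecEqBy eq (x Vec.∷ xs) (y Vec.∷ ys) = eq x y ∧ vecEqBy eq xs ys

subsetEq : {n : ℕ} → Subset n → Subset n → Bool
subsetEq = vecEqBy (λ a b → does (a Bool.≟ b))

members : {n : ℕ} → Subset n → List (Fin n)
members {n} S = filter (_∈? S) (allFin n)

unionAll : {n : ℕ} → List (Subset n) → Subset n
unionAll = foldr _∪_ ⊥

natMem : ℕ → List ℕ → Bool
natMem c C = any (λ d → does (c Nat.≟ d)) C

sequenceL : {A : Set} → List (List A) → List (List A)
sequenceL []         = [] ∷ []
sequenceL (xs ∷ xss) = cartesianProductWith _∷_ xs (sequenceL xss)

-- ⋂ of the choice sets is nonempty (⋂ of the empty family = ℕ ≠ ∅)
intersectionNonempty : {n : ℕ} {T : Set} → List (Transition n T) → Bool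
intersectionNonempty []        = true
intersectionNonempty (δ ∷ δs)  =
  any (λ c → all (λ δ' → natMem c (choices δ')) δs) (choices δ)

module Entail (Th : Theory) (A B : LSTA Th) where
  open Theory Th

  nA = LSTA.nStates A
  nB = LSTA.nStates B

  TransA = Transition nA Term
  TransB = Transition nB Term

  feas : {n : ℕ} → List (Transition n Term) → Subset n → List (List (Transition n Term))
  feas Δ D =
    filter (λ Γ → Bool.T? (intersectionNonempty Γ))
      (sequenceL (map (λ q → filter (λ δ → top δ Fin.≟ q) Δ) (members D)))

  -- f : states of A ↦ sets of states of B (absent key = empty set)
  SMap = Vec (Subset nB) nA
  -- g : terms ↦ sets of terms, as a finite relation
  TMap = List (Term × Term)

  Item = Subset nA × List (SMap × TMap)

  termEq : Term → Term → Bool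
  termEq u v = does (u ≟ₜ v)

  pairEq : Term × Term → Term × Term → Bool
  pairEq (a , b) (c , d) = termEq a c ∧ termEq b d

  fgEq : SMap × TMap → SMap × TMap → Bool
  fgEq (f , g) (f' , g') = vecEqBy subsetEq f f' ∧ setEqBy pairEq g g'

  itemEq : Item → Item → Bool
  itemEq (D , F) (D' , F') = subsetEq D D' ∧ setEqBy fgEq F F'

  emptyS : SMap
  emptyS = replicate nA ⊥

  addS : Fin nA → Fin nB → SMap → SMap
  addS p q f = updateAt f p (λ S → S ∪ ⁅ q ⁆)

  findTop : Fin nB → List TransB → Maybe TransB
  findTop q []       = nothing
  findTop q (δ ∷ Γ)  = if does (top δ Fin.≟ q) then just δ else findTop q Γ

  stepPair : List TransB → TransA → Fin nB → Maybe (SMap × TMap) → Maybe (SMap × TMap)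
  stepPair ΓB δA q nothing = nothing
  stepPair ΓB δA q (just (f' , g')) with findTop q ΓB
  ... | nothing = nothing
  ... | just δB with shape δA | shape δB
  ...   | leaf u1 | leaf u2 = just (f' , (u1 , u2) ∷ g')
  ...   | internal a l r | internal b l' r' =
            if does (a Nat.≟ b) then just (addS r r' (addS l l' f') , g') else nothing
  ...   | _ | _ = nothing

  processΓB : List TransA → SMap → List TransB → Maybe (SMap × TMap)
  processΓB ΓA f ΓB =
    foldl (λ acc δA → foldl (λ acc' q → stepPair ΓB δA q acc')
                            acc (members (Vec.lookup f (top δA))))
          (just (emptyS , [])) ΓA

  justs : {X : Set} → List (Maybe X) → List X
  justs []              = []
  justs (nothing ∷ xs)  = justs xs
  justs (just x ∷ xs)   = x ∷ justs xs

  FindAllMappings : List TransA → SMap → List (SMap × TMap)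
  FindAllMappings ΓA f =
    justs (map (processΓB ΓA f) (feas (LSTA.trans B) (unionAll (Vec.toList f))))

  bots : TransA → Subset nA
  bots δ with shape δ
  ... | internal _ l r = ⁅ l ⁆ ∪ ⁅ r ⁆
  ... | leaf _         = ⊥

  successor : List (SMap × TMap) → List TransA → Item
  successor F ΓA =
    unionAll (map bots ΓA) ,
    concatMap (λ { (f , g) → map (λ { (f' , g') → (f' , g ++ g') })
                                 (FindAllMappings ΓA f) }) F

  insertAll : List Item → List Item → List Item → List Item
  insertAll P W []        = W
  insertAll P W (x ∷ xs)  =
    if memBy itemEq x (P ++ W) then insertAll P W xs
                               else insertAll P (W ++ x ∷ []) xs

  isEmpty : Subset nA → Bool
  isEmpty D = null (members D)

  theFormula : List (SMap × TMap) → Formula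
  theFormula F = entailFormula (LSTA.constraint A) (LSTA.constraint B) (map proj₂ F)

  initial-workset : List Item
  initial-workset =
    map (λ q → ⁅ q ⁆ , map (λ r → addS q r emptyS , []) (members (LSTA.roots B)))
        (members (LSTA.roots A))

  data Config : Set where
    running : (processed workset : List Item) → Config
    done    : Bool → Config

  initial : Config
  initial = running [] initial-workset

  -- one iteration of the while loop; the item removed from the workset
  -- is chosen nondeterministically (W₁ ++ x ∷ W₂)
  data Step : Config → Config → Set where
    finish   : ∀ P → Step (running P []) (done true)
    emptyBad : ∀ P W₁ W₂ D F → Bool.T (isEmpty D) →
               ¬ Valid (theFormula F) →
               Step (running P (W₁ ++ (D , F) ∷ W₂)) (done false)
    emptyOk  : ∀ P W₁ W₂ D F → Bool.T (isEmpty D) →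
               Valid (theFormula F) →
               Step (running P (W₁ ++ (D , F) ∷ W₂))
                    (running ((D , F) ∷ P) (W₁ ++ W₂))
    expand   : ∀ P W₁ W₂ D F → Bool.T (not (isEmpty D)) →
               Step (running P (W₁ ++ (D , F) ∷ W₂))
                    (running ((D , F) ∷ P)
                             (insertAll ((D , F) ∷ P) (W₁ ++ W₂)
                                (map (successor F) (feas (LSTA.trans A) D))))

  StepBack : Config → Config → Set
  StepBack c' c = Step c c'

{-# OPTIONS --safe #-}
-- Each iteration moves one item from the workset to processed, and insertAll never admits an
-- item that is set-equal (itemEq) to one already in processed ∪ workset.  In every item (D, F)
-- that arises, D ⊆ Q_A, each f maps Q_A to subsets of Q_B, and each g only relates leaf symbols
-- of A to leaf symbols of B.  Replacing every finite set by its indicator vector over the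
-- corresponding finite universe therefore yields a code with finitely many values that
-- determines an item up to itemEq.  So the items of processed ∪ workset have pairwise distinct
-- codes, and the number of iterations is bounded by the number of codes.
module Submission where

open import Defs
open import Data.Bool using (Bool; true; false; T)
open import Data.Bool.Properties using (T-∧; T-≡)
import Data.Bool as Bool
open import Data.Empty using (⊥-elim)
open import Data.Fin using (Fin; zero; suc)
import Data.Fin as Fin
open import Data.Fin.Properties using (injective⇒≤)
open import Data.Fin.Subset using (Subset; ⁅_⁆) renaming (_∈_ to _∈ₛ_)
open import Data.Fin.Subset.Properties using (x∈⁅x⁆; x∈⁅y⁆⇒x≡y)
open import Data.List
  using (List; []; _∷_; _++_; [_]; map; concatMap; foldl; lookup; length; cartesianProduct; cartesianProductWith)
open import Data.List.Properties using (length-++; length-map; map-∘; ++-assoc)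
open import Data.List.Membership.Propositional using (_∈_; _∉_; lose)
open import Data.List.Membership.Propositional.Properties
  using (∈-lookup; ∈-map⁺; ∈-map⁻; ∈-concatMap⁺; ∈-cartesianProduct⁺;
         ∈-cartesianProductWith⁺; ∈-cartesianProductWith⁻)
import Data.List.Membership.DecPropositional as DecMembership
open import Data.List.Relation.Binary.Subset.Propositional using (_⊆_)
open import Data.List.Relation.Binary.Subset.Propositional.Properties using (filter-⊆)
open import Data.List.Relation.Binary.Permutation.Propositional using (_↭_; ↭-trans; ↭-reflexive; ↭⇒↭ₛ)
import Data.List.Relation.Binary.Permutation.Propositional.Properties as ↭
import Data.List.Relation.Binary.Permutation.Setoid.Properties as ↭ₛ
open import Data.List.Relation.Unary.All using (All; []; _∷_)
import Data.List.Relation.Unary.All as All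
import Data.List.Relation.Unary.All.Properties as All
open import Data.List.Relation.Unary.Any using (Any; here; there; index)
open import Data.List.Relation.Unary.Any.Properties using (lookup-index; any⁺)
open import Data.List.Relation.Unary.Enumerates.Setoid using (IsEnumeration)
open import Data.List.Relation.Unary.Unique.Propositional using (Unique; _∷_)
import Data.List.Relation.Unary.Unique.Propositional.Properties as Unique
open import Data.Maybe using (just; nothing)
import Data.Maybe.Relation.Unary.All as Maybe
import Data.Maybe.Properties as Maybe
open import Data.Nat using (ℕ; zero; suc; _≤_; _<_; _∸_; z<s; s<s)
import Data.Nat as Nat
open import Data.Nat.Induction using (<-wellFounded)
open import Data.Nat.Properties using (m≤m+n; ∸-monoʳ-<; n<1+n; module ≤-Reasoning)
open import Data.Product using (_×_; _,_; proj₁)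
open import Data.Product.Properties using (×-≡,≡←≡)
import Data.Product.Properties as Product
open import Data.Unit using (⊤; tt)
open import Data.Vec using (Vec)
import Data.Vec as Vec
import Data.Vec.Properties as Vec
open import Function using (_∘_; Injective; Equivalence)
open import Induction.WellFounded using (Acc; acc)
open import Relation.Binary.Core using (Rel)
open import Relation.Binary.Definitions using (DecidableEquality)
open import Relation.Binary.PropositionalEquality using (_≡_; refl; sym; cong; subst; module ≡-Reasoning)
import Relation.Binary.PropositionalEquality as ≡
open import Relation.Nullary using (¬_; does; yes; no)
open import Relation.Nullary.Decidable using (dec-true)
open import Relation.Unary using (Pred)
open import Level using (0ℓ)

module _ {A : Set} where

  lookup-injective : ∀ {xs : List A} → Unique xs → ∀ {i j} → lookup xs i ≡ lookup xs j → i ≡ j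
  lookup-injective (x∉xs ∷ u) {zero}  {zero}  _ = refl
  lookup-injective (x∉xs ∷ u) {zero}  {suc j} e = ⊥-elim (All.lookup x∉xs (∈-lookup j) e)
  lookup-injective (x∉xs ∷ u) {suc i} {zero}  e = ⊥-elim (All.lookup x∉xs (∈-lookup i) (sym e))
  lookup-injective (x∉xs ∷ u) {suc i} {suc j} e = cong suc (lookup-injective u e)

  Unique⇒length≤ : ∀ {xs ys : List A} → Unique xs → xs ⊆ ys → length xs ≤ length ys
  Unique⇒length≤ {xs} {ys} u xs⊆ys = injective⇒≤ position-injective
    where
    position : Fin (length xs) → Fin (length ys)
    position i = index (xs⊆ys (∈-lookup i))

    position-injective : Injective _≡_ _≡_ position
    position-injective {i} {j} e = lookup-injective u (begin
      lookup xs i            ≡⟨ lookup-index (xs⊆ys (∈-lookup i)) ⟩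
      lookup ys (position i) ≡⟨ cong (lookup ys) e ⟩
      lookup ys (position j) ≡⟨ sym (lookup-index (xs⊆ys (∈-lookup j))) ⟩
      lookup xs j            ∎)
      where open ≡-Reasoning

  vecsOver : ∀ n → List A → List (Vec A n)
  vecsOver zero    xs = [ Vec.[] ]
  vecsOver (suc n) xs = cartesianProductWith Vec._∷_ xs (vecsOver n xs)

  vecsOver-enumerates : ∀ {n xs} → IsEnumeration (≡.setoid A) xs →
                        IsEnumeration (≡.setoid (Vec A n)) (vecsOver n xs)
  vecsOver-enumerates enum Vec.[]       = here refl
  vecsOver-enumerates enum (x Vec.∷ v) =
    ∈-cartesianProductWith⁺ Vec._∷_ (enum x) (vecsOver-enumerates enum v)

bools : List Bool
bools = true ∷ false ∷ []

bools-enumerates : IsEnumeration (≡.setoid Bool) bools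
bools-enumerates true  = here refl
bools-enumerates false = there (here refl)

subsets : ∀ n → List (Subset n)
subsets n = vecsOver n bools

subsets-enumerates : ∀ {n} → IsEnumeration (≡.setoid (Subset n)) (subsets n)
subsets-enumerates = vecsOver-enumerates bools-enumerates

×-enumerates : ∀ {A B : Set} {xs : List A} {ys : List B} →
               IsEnumeration (≡.setoid A) xs → IsEnumeration (≡.setoid B) ys →
               IsEnumeration (≡.setoid (A × B)) (cartesianProduct xs ys)
×-enumerates enumA enumB (x , y) = ∈-cartesianProduct⁺ (enumA x) (enumB y)

module _ {K : Set} (_≟_ : DecidableEquality K) where
  open DecMembership _≟_ using (_∈?_)

  indicator : (U : List K) → List K → Subset (length U)
  indicator []      ks = Vec.[]
  indicator (u ∷ U) ks = does (u ∈? ks) Vec.∷ indicator U ks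

  indicator-reflects : ∀ {U ks ks' k} → k ∈ U → k ∈ ks →
                       indicator U ks ≡ indicator U ks' → k ∈ ks'
  indicator-reflects {ks = ks} {ks'} {k} (here refl) k∈ks e
    with k ∈? ks | k ∈? ks' | Vec.∷-injectiveˡ e
  ... | yes _   | yes k∈ks' | _  = k∈ks'
  ... | yes _   | no _      | ()
  ... | no k∉ks | _         | _  = ⊥-elim (k∉ks k∈ks)
  indicator-reflects (there k∈U) k∈ks e = indicator-reflects k∈U k∈ks (Vec.∷-injectiveʳ e)

module _ {A : Set} (eq : A → A → Bool) where

  subBy-complete : ∀ {xs ys} → (∀ {x} → x ∈ xs → Any (T ∘ eq x) ys) → T (subBy eq xs ys)
  subBy-complete covered = All.all⁻ _ (All.tabulate (any⁺ _ ∘ covered))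

  setEqBy-complete : ∀ {xs ys} →
                     (∀ {x} → x ∈ xs → Any (T ∘ eq x) ys) →
                     (∀ {y} → y ∈ ys → Any (T ∘ eq y) xs) →
                     T (setEqBy eq xs ys)
  setEqBy-complete xs⊑ys ys⊑xs =
    Equivalence.from T-∧ (subBy-complete xs⊑ys , subBy-complete ys⊑xs)

  vecEqBy-refl : (∀ x → T (eq x x)) → ∀ {n} (v : Vec A n) → T (vecEqBy eq v v)
  vecEqBy-refl eq-refl Vec.[]       = tt
  vecEqBy-refl eq-refl (x Vec.∷ v) = Equivalence.from T-∧ (eq-refl x , vecEqBy-refl eq-refl v)

does-refl : ∀ {A : Set} (_≟_ : DecidableEquality A) x → T (does (x ≟ x))
does-refl _≟_ x = Equivalence.from T-≡ (dec-true (x ≟ x) refl)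

foldl-preserves : ∀ {A B : Set} (P : Pred B 0ℓ) (Q : Pred A 0ℓ) {f : B → A → B} →
                  (∀ {b a} → Q a → P b → P (f b a)) →
                  ∀ {b xs} → All Q xs → P b → P (foldl f b xs)
foldl-preserves P Q pres []         Pb = Pb
foldl-preserves P Q pres (Qx ∷ Qxs) Pb = foldl-preserves P Q pres Qxs (pres Qx Pb)

sequenceL-All : ∀ {A : Set} {P : Pred A 0ℓ} {xss ys} → All (All P) xss → ys ∈ sequenceL xss → All P ys
sequenceL-All {xss = []}       []            (here refl) = []
sequenceL-All {xss = xs ∷ xss} (Pxs ∷ Pxss) ys∈
  with _ , _ , x∈xs , ys'∈ , refl ← ∈-cartesianProductWith⁻ _∷_ xs (sequenceL xss) ys∈
  = All.lookup Pxs x∈xs ∷ sequenceL-All Pxss ys'∈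

module _ {A : Set} {_≺_ : Rel A 0ℓ} (I : Pred A 0ℓ) (μ : A → ℕ)
         (decreasing : ∀ {x y} → y ≺ x → I x → I y × μ y < μ x) where

  decreasing-measure⇒Acc : ∀ {x} → I x → Acc _≺_ x
  decreasing-measure⇒Acc {x} Ix = go Ix (<-wellFounded (μ x))
    where
    go : ∀ {x} → I x → Acc _<_ (μ x) → Acc _≺_ x
    go Ix (acc rs) = acc λ y≺x → let Iy , μy<μx = decreasing y≺x Ix in go Iy (rs μy<μx)

leafSymbol : ∀ {n T} → Shape n T → List T
leafSymbol (internal _ _ _) = []
leafSymbol (leaf u)         = [ u ]

leafSymbols : ∀ {n T} → List (Transition n T) → List T
leafSymbols = concatMap (leafSymbol ∘ shape)

∈-leafSymbols : ∀ {n T} {δ : Transition n T} {Δ u} → δ ∈ Δ → shape δ ≡ leaf u → u ∈ leafSymbols Δ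
∈-leafSymbols δ∈Δ shape≡leaf =
  ∈-concatMap⁺ (leafSymbol ∘ shape) (lose δ∈Δ (subst (λ s → _ ∈ leafSymbol s) (sym shape≡leaf) (here refl)))

module Termination (Th : Theory) (A B : LSTA Th) where
  open Theory Th
  open Entail Th A B

  ΔA : List TransA
  ΔA = LSTA.trans A

  ΔB : List TransB
  ΔB = LSTA.trans B

  feas-⊆ : ∀ {n} (Δ : List (Transition n Term)) {D Γ} → Γ ∈ feas Δ D → All (_∈ Δ) Γ
  feas-⊆ Δ {D} Γ∈ = sequenceL-All
    (All.map⁺ (All.universal (λ q → All.tabulate (filter-⊆ (λ δ → top δ Fin.≟ q) Δ)) (members D)))
    (filter-⊆ (λ Γ → Bool.T? (intersectionNonempty Γ)) _ Γ∈)

  leafPairs : List (Term × Term)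
  leafPairs = cartesianProduct (leafSymbols ΔA) (leafSymbols ΔB)

  WellFormedMap : SMap × TMap → Set
  WellFormedMap (f , g) = All (_∈ leafPairs) g

  WellFormed : Item → Set
  WellFormed (D , F) = All WellFormedMap F

  findTop-∈ : ∀ q Γ {δ} → findTop q Γ ≡ just δ → δ ∈ Γ
  findTop-∈ q (δ ∷ Γ) found with does (top δ Fin.≟ q)
  ... | true  = here (sym (Maybe.just-injective found))
  ... | false = there (findTop-∈ q Γ found)

  stepPair-wf : ∀ {ΓB δA q acc} → All (_∈ ΔB) ΓB → δA ∈ ΔA →
                Maybe.All WellFormedMap acc → Maybe.All WellFormedMap (stepPair ΓB δA q acc)
  stepPair-wf {acc = nothing} _ _ _ = Maybe.nothing
  stepPair-wf {ΓB} {δA} {q} {just (f , g)} ΓB⊆ΔB δA∈ΔA (Maybe.just wf) with findTop q ΓB in found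
  ... | nothing = Maybe.nothing
  ... | just δB with shape δA in shapeA | shape δB in shapeB
  ...   | leaf _ | leaf u₂ = Maybe.just (∈-cartesianProduct⁺ (∈-leafSymbols δA∈ΔA shapeA) u₂∈ ∷ wf)
    where
    u₂∈ : u₂ ∈ leafSymbols ΔB
    u₂∈ = ∈-leafSymbols (All.lookup ΓB⊆ΔB (findTop-∈ q ΓB found)) shapeB
  ...   | internal a _ _ | internal b _ _ with does (a Nat.≟ b)
  ...     | true  = Maybe.just wf
  ...     | false = Maybe.nothing
  stepPair-wf _ _ _ | just _ | leaf _         | internal _ _ _ = Maybe.nothing
  stepPair-wf _ _ _ | just _ | internal _ _ _ | leaf _         = Maybe.nothing

  processΓB-wf : ∀ {ΓA f ΓB} → All (_∈ ΔA) ΓA → All (_∈ ΔB) ΓB →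
                 Maybe.All WellFormedMap (processΓB ΓA f ΓB)
  processΓB-wf {f = f} ΓA⊆ΔA ΓB⊆ΔB =
    foldl-preserves (Maybe.All WellFormedMap) (_∈ ΔA)
      (λ {_} {δA} δA∈ΔA → foldl-preserves (Maybe.All WellFormedMap) (λ _ → ⊤)
                   (λ _ → stepPair-wf ΓB⊆ΔB δA∈ΔA) (All.universal _ (members (Vec.lookup f (top δA)))))
      ΓA⊆ΔA (Maybe.just [])

  justs-All : ∀ {X : Set} {P : Pred X 0ℓ} {ms} → All (Maybe.All P) ms → All P (justs ms)
  justs-All []                    = []
  justs-All (Maybe.nothing ∷ Pms) = justs-All Pms
  justs-All (Maybe.just Px ∷ Pms) = Px ∷ justs-All Pms

  FindAllMappings-wf : ∀ {ΓA f} → All (_∈ ΔA) ΓA → All WellFormedMap (FindAllMappings ΓA f)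
  FindAllMappings-wf {f = f} ΓA⊆ΔA =
    justs-All (All.map⁺ (All.tabulate λ ΓB∈ → processΓB-wf {f = f} ΓA⊆ΔA (feas-⊆ ΔB ΓB∈)))

  successor-wf : ∀ {F ΓA} → All WellFormedMap F → All (_∈ ΔA) ΓA → WellFormed (successor F ΓA)
  successor-wf wfF ΓA⊆ΔA = All.concat⁺ (All.map⁺ (All.map
    (λ { {f , g} wfg → All.map⁺ (All.map (λ { {f' , g'} wfg' → All.++⁺ wfg wfg' })
                                          (FindAllMappings-wf {f = f} ΓA⊆ΔA)) })
    wfF))

  pair≟ : DecidableEquality (Term × Term)
  pair≟ = Product.≡-dec _≟ₜ_ _≟ₜ_

  MapCode : Set
  MapCode = SMap × Subset (length leafPairs)

  mapCode≟ : DecidableEquality MapCode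
  mapCode≟ = Product.≡-dec (Vec.≡-dec (Vec.≡-dec Bool._≟_)) (Vec.≡-dec Bool._≟_)

  mapCode : SMap × TMap → MapCode
  mapCode (f , g) = f , indicator pair≟ leafPairs g

  mapCodes : List MapCode
  mapCodes = cartesianProduct (vecsOver nA (subsets nB)) (subsets (length leafPairs))

  mapCodes-enumerates : IsEnumeration (≡.setoid MapCode) mapCodes
  mapCodes-enumerates = ×-enumerates (vecsOver-enumerates subsets-enumerates) subsets-enumerates

  Code : Set
  Code = Subset nA × Subset (length mapCodes)

  code : Item → Code
  code (D , F) = D , indicator mapCode≟ mapCodes (map mapCode F)

  codes : List Code
  codes = cartesianProduct (subsets nA) (subsets (length mapCodes))

  codes-enumerates : IsEnumeration (≡.setoid Code) codes
  codes-enumerates = ×-enumerates subsets-enumerates subsets-enumerates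

  pairEq-refl : ∀ p → T (pairEq p p)
  pairEq-refl (u , v) = Equivalence.from T-∧ (does-refl _≟ₜ_ u , does-refl _≟ₜ_ v)

  subsetEq-refl : ∀ {n} (S : Subset n) → T (subsetEq S S)
  subsetEq-refl = vecEqBy-refl _ (does-refl Bool._≟_)

  fgEq-complete : ∀ {a b} → WellFormedMap a → WellFormedMap b → mapCode a ≡ mapCode b → T (fgEq a b)
  fgEq-complete {f , g} {f' , g'} wfg wfg' e with refl , eg ← ×-≡,≡←≡ e =
    Equivalence.from T-∧
      (vecEqBy-refl _ subsetEq-refl f , setEqBy-complete pairEq (covered wfg eg) (covered wfg' (sym eg)))
    where
    covered : ∀ {h h'} → All (_∈ leafPairs) h →
              indicator pair≟ leafPairs h ≡ indicator pair≟ leafPairs h' →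
              ∀ {p} → p ∈ h → Any (T ∘ pairEq p) h'
    covered wfh eh p∈h = lose (indicator-reflects pair≟ (All.lookup wfh p∈h) p∈h eh) (pairEq-refl _)

  itemEq-complete : ∀ {x y} → WellFormed x → WellFormed y → code x ≡ code y → T (itemEq x y)
  itemEq-complete {D , F} {D' , F'} wfF wfF' e with refl , eF ← ×-≡,≡←≡ e =
    Equivalence.from T-∧
      (subsetEq-refl D , setEqBy-complete fgEq (covered wfF wfF' eF) (covered wfF' wfF (sym eF)))
    where
    covered : ∀ {G G'} → All WellFormedMap G → All WellFormedMap G' →
              indicator mapCode≟ mapCodes (map mapCode G) ≡ indicator mapCode≟ mapCodes (map mapCode G') →
              ∀ {a} → a ∈ G → Any (T ∘ fgEq a) G'
    covered wfG wfG' eG {a} a∈G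
      with b , b∈G' , ea ← ∈-map⁻ mapCode
             (indicator-reflects mapCode≟ (mapCodes-enumerates (mapCode a)) (∈-map⁺ mapCode a∈G) eG)
      = lose b∈G' (fgEq-complete (All.lookup wfG a∈G) (All.lookup wfG' b∈G') ea)

  Invariant : List Item → Set
  Invariant items = All WellFormed items × Unique (map code items)

  Invariant-resp-↭ : ∀ {xs ys} → xs ↭ ys → Invariant xs → Invariant ys
  Invariant-resp-↭ xs↭ys (wf , u) =
    ↭.All-resp-↭ xs↭ys wf , ↭ₛ.Unique-resp-↭ (≡.setoid Code) (↭⇒↭ₛ (↭.map⁺ code xs↭ys)) u

  Invariant-∷ : ∀ {x items} → WellFormed x → ¬ T (memBy itemEq x items) →
                Invariant items → Invariant (x ∷ items)
  Invariant-∷ {x} {items} wfx x∉items (wf , u) = wfx ∷ wf , All.¬Any⇒All¬ _ fresh ∷ u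
    where
    fresh : code x ∉ map code items
    fresh cx∈ with y , y∈ , e ← ∈-map⁻ code cx∈ =
      x∉items (any⁺ _ (lose y∈ (itemEq-complete wfx (All.lookup wf y∈) e)))

  insertAll-invariant : ∀ P W {xs} → All WellFormed xs →
                        Invariant (P ++ W) → Invariant (P ++ insertAll P W xs)
  insertAll-invariant P W []           inv = inv
  insertAll-invariant P W {x ∷ _} (wfx ∷ wfxs) inv with memBy itemEq x (P ++ W) in isMember
  ... | true  = insertAll-invariant P W wfxs inv
  ... | false = insertAll-invariant P (W ++ [ x ]) wfxs
                  (Invariant-resp-↭ appended (Invariant-∷ wfx (subst T isMember) inv))
    where
    appended : x ∷ P ++ W ↭ P ++ W ++ [ x ]
    appended = ↭-trans (↭.∷↭∷ʳ x (P ++ W)) (↭-reflexive (++-assoc P W [ x ]))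

  select-invariant : ∀ P W₁ x W₂ → Invariant (P ++ W₁ ++ x ∷ W₂) → Invariant (x ∷ P ++ W₁ ++ W₂)
  select-invariant P W₁ x W₂ =
    Invariant-resp-↭ (↭-trans (↭.++⁺ˡ P (↭.shift x W₁ W₂)) (↭.shift x P (W₁ ++ W₂)))

  Invariant⇒length≤ : ∀ P W → Invariant (P ++ W) → length P ≤ length codes
  Invariant⇒length≤ P W (_ , u) = begin
    length P                  ≤⟨ m≤m+n (length P) (length W) ⟩
    length P Nat.+ length W   ≡⟨ sym (length-++ P) ⟩
    length (P ++ W)           ≡⟨ sym (length-map code (P ++ W)) ⟩
    length (map code (P ++ W)) ≤⟨ Unique⇒length≤ u (λ _ → codes-enumerates _) ⟩
    length codes              ∎
    where open ≤-Reasoning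

  ConfigInvariant : Config → Set
  ConfigInvariant (running P W) = Invariant (P ++ W)
  ConfigInvariant (done _)      = ⊤

  -- The suc makes the final step to done decrease as well.
  remaining : Config → ℕ
  remaining (running P W) = suc (length codes ∸ length P)
  remaining (done _)      = 0

  processing-decreases : ∀ P x W → Invariant (x ∷ P ++ W) →
                         length codes ∸ length (x ∷ P) < length codes ∸ length P
  processing-decreases P x W inv = ∸-monoʳ-< (n<1+n _) (Invariant⇒length≤ (x ∷ P) W inv)

  step-decreases : ∀ {c c'} → Step c c' → ConfigInvariant c →
                   ConfigInvariant c' × remaining c' < remaining c
  step-decreases (finish _)                _ = tt , z<s
  step-decreases (emptyBad _ _ _ _ _ _ _) _ = tt , z<s
  step-decreases (emptyOk P W₁ W₂ D F _ _) inv =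
    inv' , s<s (processing-decreases P (D , F) _ inv')
    where
    inv' : Invariant ((D , F) ∷ P ++ W₁ ++ W₂)
    inv' = select-invariant P W₁ (D , F) W₂ inv
  step-decreases (expand P W₁ W₂ D F _) inv =
    inv'' , s<s (processing-decreases P (D , F) _ inv'')
    where
    inv' : Invariant ((D , F) ∷ P ++ W₁ ++ W₂)
    inv' = select-invariant P W₁ (D , F) W₂ inv

    successors-wf : All WellFormed (map (successor F) (feas ΔA D))
    successors-wf = All.map⁺ (All.tabulate λ Γ∈ → successor-wf (All.head (proj₁ inv')) (feas-⊆ ΔA Γ∈))

    inv'' : Invariant ((D , F) ∷ P ++ insertAll ((D , F) ∷ P) (W₁ ++ W₂) (map (successor F) (feas ΔA D)))
    inv'' = insertAll-invariant ((D , F) ∷ P) (W₁ ++ W₂) successors-wf inv'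

  rootItem : Fin nA → Item
  rootItem q = ⁅ q ⁆ , map (λ r → addS q r emptyS , []) (members (LSTA.roots B))

  initial-invariant : ConfigInvariant initial
  initial-invariant =
    All.map⁺ (All.universal (λ _ → All.map⁺ (All.universal (λ _ → []) _)) _) ,
    subst Unique (map-∘ (members (LSTA.roots A)))
      (Unique.map⁺ rootItem-injective (Unique.filter⁺ _ (Unique.allFin⁺ nA)))
    where
    rootItem-injective : ∀ {q q'} → code (rootItem q) ≡ code (rootItem q') → q ≡ q'
    rootItem-injective {q} {q'} e = x∈⁅y⁆⇒x≡y q' (subst (q ∈ₛ_) (cong proj₁ e) (x∈⁅x⁆ q))

theorem2 : (Th : Theory) (A B : LSTA Th) →
    Acc (Entail.StepBack Th A B) (Entail.initial Th A B)
theorem2 Th A B = decreasing-measure⇒Acc ConfigInvariant remaining step-decreases initial-invariant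
  where open Termination Th A B
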